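{- Let $X$ be a finite connected graph of genus $g$, let $B\subset V(X)$ be a subset of vertices, and let $G$ be a finite group. For each $b\in B$, let $(G_b,Y_b)\rightarrow b$ be a connected harmonic $G_b$-cover of the point $b$, where $G_b$ is isomorphic to a subgroup of $G$. For each $b\in B$ choose an embedding $\varphi_b:G_b\hookrightarrow G$, and let $G(B)$ be the subgroup of $G$ generated by the images $\varphi_b(G_b)$, $b\in B$. Assume that $G=\langle G(B),\gamma_1,\dots,\gamma_g\rangle$ for some elements $\gamma_1,\dots,\gamma_g\in G$. Then there exists a connected harmonic $G$-cover $(G,\mathcal{Y})\rightarrow X$, totally split outside of $B$, such that for each $b\in B$ the fiber $(G,\mathcal{Y}_b)\rightarrow b$ is isomorphic (as a graph with $G$-action) to the $G$-cover of $b$ induced via $\varphi_b$ from the given $G_b$-cover $(G_b,Y_b)\rightarrow b$.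
   Context: A graph is a finite multigraph without loop edges; the genus of a connected graph $X$ is $|E(X)|-|V(X)|+1$. For a vertex $v$, $v(1)$ is the subgraph consisting of $v$, its neighbours and the edges incident to $v$. A morphism of graphs $\phi:Y\to X$ maps vertices to vertices and each edge with endpoints $y_1\ne y_2$ either to an edge with endpoints $\phi(y_1)\ne\phi(y_2)$ or to the vertex $\phi(y_1)=\phi(y_2)$. It is harmonic if for each vertex $y$ the number of edges of $y(1)$ mapped to $e'$ is independent of the edge $e'$ of $\phi(y)(1)$. For a finite group $G\le\mathrm{Aut}(Y)$, the quotient $G\backslash Y$ has vertices the orbits of vertices and edges the orbits of edges with endpoints in different orbits; $(G,Y)$ (with each component stabilizer acting faithfully on its component) is a harmonic action if every quotient morphism $Y\to H\backslash Y$, $H\le G$, is harmonic, and unflipped if no non-identity element of $G$ fixes an edge. A connected harmonic $G$-cover $(G,Y)\to X$ of a connected graph $X$ consists of a connected graph $Y$ with an unflipped harmonic action of the finite group $G\le\mathrm{Aut}(Y)$ and a harmonic morphism $f:Y\to X$ with $f(g\alpha)=f(\alpha)$ for all $g$ and vertices/edges $\alpha$, inducing an isomorphism $G\backslash Y\cong X$. In particular, a connected harmonic $G_b$-cover of the point $b$ is a connected graph $Y_b$ with an unflipped harmonic action of $G_b$ that is transitive on vertices (quotient a single vertex). For $z\in V(X)$ the fiber $Y_z$ is the subgraph with vertices $f^{ -1}(z)$ and the edges mapped to the vertex $z$, with its induced $G$-action. The cover is totally split at $z$ if the stabilizer in $G$ of each connected component of $Y_z$ is trivial; totally split outside $B$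 means this holds for every $z\notin B$. The $G$-cover of $b$ induced via $\varphi_b$ from $(G_b,Y_b)$ is the graph $G\times_{G_b}Y_b$, the quotient of $G\times Y_b$ by $(g\varphi_b(h),\alpha)\sim(g,h\alpha)$ for $h\in G_b$, with $G$ acting by left multiplication on the first factor; it is a disjoint union of $[G:\varphi_b(G_b)]$ copies of $Y_b$. -}

module Defs where

open import Level using (0ℓ)
open import Data.Nat using (ℕ; zero; suc; _+_; _∸_; _<_)
open import Data.Fin using (Fin)
open import Data.Fin.Properties using (_≟_)
open import Data.Fin.Subset using (Subset; _∈_)
open import Data.Sum using (_⊎_; inj₁; inj₂)
open import Data.Product using (Σ; ∃; ∃₂; _×_; _,_)
open import Data.Bool using (Bool; true; false; _∧_; _∨_; if_then_else_)
open import Data.Unit using (⊤)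
open import Relation.Nullary using (does)
open import Relation.Binary.PropositionalEquality using (_≡_; _≢_)
open import Relation.Binary.Construct.Closure.ReflexiveTransitive using (Star)
open import Algebra.Structures using (IsGroup)
open import Algebra.Bundles.Raw using (RawGroup)
open import Algebra.Morphism.Structures using (module GroupMorphisms)

-- Each edge e has two (distinct) endpoints src e, tgt e; the labelling
-- src/tgt is only a bookkeeping device, edges are UNORIENTED: every
-- notion below only uses the unordered pair of endpoints (HasEnds).

record Graph : Set where
  field
    nV nE  : ℕ
    src tgt : Fin nE → Fin nV
    noLoop : ∀ e → src e ≢ tgt e
open Graph public

HasEnds : (Y : Graph) → Fin (nE Y) → Fin (nV Y) → Fin (nV Y) → Set
HasEnds Y e a b = (src Y e ≡ a × tgt Y e ≡ b) ⊎ (src Y e ≡ b × tgt Y e ≡ a)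

Incident : (Y : Graph) → Fin (nV Y) → Fin (nE Y) → Set
Incident Y v e = src Y e ≡ v ⊎ tgt Y e ≡ v

incident? : (Y : Graph) → Fin (nV Y) → Fin (nE Y) → Bool
incident? Y v e = does (src Y e ≟ v) ∨ does (tgt Y e ≟ v)

count : ∀ {n} → (Fin n → Bool) → ℕ
count {zero}  p = 0
count {suc n} p = (if p Fin.zero then 1 else 0) + count (λ i → p (Fin.suc i))

Adjacent : (Y : Graph) → Fin (nV Y) → Fin (nV Y) → Set
Adjacent Y a b = ∃ λ e → HasEnds Y e a b

Connected : Graph → Set
Connected Y = (0 < nV Y) × (∀ a b → Star (Adjacent Y) a b)

genus : Graph → ℕ
genus X = nE X + 1 ∸ nV X

pointGraph : Graph
pointGraph = record { nV = 1 ; nE = 0 ; src = λ () ; tgt = λ () ; noLoop = λ () }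

record Morphism (Y X : Graph) : Set where
  field
    fV : Fin (nV Y) → Fin (nV X)
    fE : Fin (nE Y) → Fin (nE X) ⊎ Fin (nV X)
    edge-ok : ∀ e e' → fE e ≡ inj₁ e' → HasEnds X e' (fV (src Y e)) (fV (tgt Y e))
    vert-ok : ∀ e v → fE e ≡ inj₂ v → (fV (src Y e) ≡ v) × (fV (tgt Y e) ≡ v)
open Morphism public

mapsTo? : ∀ {Y X} → Morphism Y X → Fin (nE Y) → Fin (nE X) → Bool
mapsTo? f e e' with fE f e
... | inj₁ e'' = does (e'' ≟ e')
... | inj₂ _   = false

local-deg : ∀ {Y X} → Morphism Y X → Fin (nV Y) → Fin (nE X) → ℕ
local-deg {Y} f y e' = count (λ e → incident? Y y e ∧ mapsTo? f e e')

IsHarmonic : ∀ {Y X} → Morphism Y X → Set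
IsHarmonic {Y} {X} f =
  ∀ y e₁ e₂ → Incident X (fV f y) e₁ → Incident X (fV f y) e₂ →
  local-deg f y e₁ ≡ local-deg f y e₂

record FinGroup : Set where
  infixl 7 _∙_
  field
    order : ℕ
    _∙_   : Fin order → Fin order → Fin order
    ε     : Fin order
    _⁻¹   : Fin order → Fin order
    isGroup : IsGroup _≡_ _∙_ ε _⁻¹

  Carrier : Set
  Carrier = Fin order

  rawGroup : RawGroup 0ℓ 0ℓ
  rawGroup = record { Carrier = Fin order ; _≈_ = _≡_ ; _∙_ = _∙_ ; ε = ε ; _⁻¹ = _⁻¹ }
open FinGroup public using (Carrier)

IsEmbedding : (H G : FinGroup) → (Carrier H → Carrier G) → Set
IsEmbedding H G φ =
  GroupMorphisms.IsGroupMonomorphism (FinGroup.rawGroup H) (FinGroup.rawGroup G) φ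

record IsSubgroup (G : FinGroup) (H : Carrier G → Set) : Set where
  open FinGroup G using (_∙_; ε; _⁻¹)
  field
    ε-mem  : H ε
    ∙-mem  : ∀ {x y} → H x → H y → H (x ∙ y)
    ⁻¹-mem : ∀ {x} → H x → H (x ⁻¹)

data Generated (G : FinGroup) (S : Carrier G → Set) : Carrier G → Set where
  gen  : ∀ {x} → S x → Generated G S x
  unit : Generated G S (FinGroup.ε G)
  mul  : ∀ {x y} → Generated G S x → Generated G S y → Generated G S (FinGroup._∙_ G x y)
  inv  : ∀ {x} → Generated G S x → Generated G S (FinGroup._⁻¹ G x)

record Action (G : FinGroup) (Y : Graph) : Set where
  open FinGroup G using (_∙_; ε)
  field
    actV : Carrier G → Fin (nV Y) → Fin (nV Y)
    actE : Carrier G → Fin (nE Y) → Fin (nE Y)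
    actV-ε : ∀ y → actV ε y ≡ y
    actE-ε : ∀ e → actE ε e ≡ e
    actV-∙ : ∀ g h y → actV (g ∙ h) y ≡ actV g (actV h y)
    actE-∙ : ∀ g h e → actE (g ∙ h) e ≡ actE g (actE h e)
    act-ends : ∀ g e → HasEnds Y (actE g e) (actV g (src Y e)) (actV g (tgt Y e))
open Action public

Faithful : ∀ {G Y} → Action G Y → Set
Faithful {G} {Y} A =
  ∀ g → (∀ y → actV A g y ≡ y) → (∀ e → actE A g e ≡ e) → g ≡ FinGroup.ε G

Unflipped : ∀ {G Y} → Action G Y → Set
Unflipped {G} {Y} A = ∀ g e → actE A g e ≡ e → g ≡ FinGroup.ε G

-- q : Y → Z exhibits Z as the quotient H\Y (H a subgroup given as a
-- predicate): vertices of Z = H-orbits of vertices, edges of Z = H-orbits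
-- of edges whose endpoints lie in different orbits (the other edges are
-- contracted, which is forced by the morphism axioms and the vertex part).
record IsQuotientBy {G : FinGroup} {Y Z : Graph} (A : Action G Y)
                    (H : Carrier G → Set) (q : Morphism Y Z) : Set where
  field
    V-surj : ∀ z → ∃ λ y → fV q y ≡ z
    V-ker₁ : ∀ y y' → fV q y ≡ fV q y' → ∃ λ h → H h × actV A h y ≡ y'
    V-ker₂ : ∀ y y' h → H h → actV A h y ≡ y' → fV q y ≡ fV q y'
    E-surj : ∀ e' → ∃ λ e → fE q e ≡ inj₁ e'
    E-ker₁ : ∀ e₁ e₂ e' → fE q e₁ ≡ inj₁ e' → fE q e₂ ≡ inj₁ e' →
             ∃ λ h → H h × actE A h e₁ ≡ e₂
    E-ker₂ : ∀ e₁ e₂ e' h → fE q e₁ ≡ inj₁ e' → H h → actE A h e₁ ≡ e₂ →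
             fE q e₂ ≡ inj₁ e'

HarmonicAction : ∀ {G Y} → Action G Y → Set₁
HarmonicAction {G} {Y} A =
  ∀ (H : Carrier G → Set) → IsSubgroup G H →
  ∀ (Z : Graph) (q : Morphism Y Z) → IsQuotientBy A H q → IsHarmonic q

record IsCover {G : FinGroup} {Y X : Graph} (A : Action G Y) (f : Morphism Y X) : Set₁ where
  field
    connected  : Connected Y
    faithful   : Faithful A
    unflipped  : Unflipped A
    harmonicA  : HarmonicAction A
    harmonicF  : IsHarmonic f
    invV       : ∀ g y → fV f (actV A g y) ≡ fV f y
    invE       : ∀ g e → fE f (actE A g e) ≡ fE f e
    quotient   : IsQuotientBy A (λ _ → ⊤) f

FiberAdj : ∀ {Y X} → Morphism Y X → Fin (nV X) → Fin (nV Y) → Fin (nV Y) → Set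
FiberAdj {Y} f z a b = ∃ λ e → fE f e ≡ inj₂ z × HasEnds Y e a b

-- the stabilizer of each connected component of Y_z is trivial
-- (g stabilizes the component C of y ∈ Y_z iff g·y ∈ C)
TotallySplitAt : ∀ {G Y X} → Action G Y → Morphism Y X → Fin (nV X) → Set
TotallySplitAt {G} A f z =
  ∀ y → fV f y ≡ z → ∀ g → Star (FiberAdj f z) y (actV A g y) → g ≡ FinGroup.ε G

TotallySplitOutside : ∀ {G Y X} → Action G Y → Morphism Y X → Subset (nV X) → Set
TotallySplitOutside A f B = ∀ z → (z ∈ B → Data.Empty.⊥) → TotallySplitAt A f z
  where import Data.Empty

-- The fiber (G, Y_b) is isomorphic, as a graph with G-action, to the
-- induced cover G ×_{G_b} Y_b = (G × Y_b)/~ where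
-- (g φ(h), α) ~ (g, h α).  The isomorphism is given by equivariant maps
-- Ψ from G × Y_b onto the vertices / edges of the fiber whose fibers are
-- exactly the ~-classes, compatible with endpoints.
record FiberIsoInduced {G Gb : FinGroup} {Y X Yb : Graph}
       (A : Action G Y) (f : Morphism Y X) (b : Fin (nV X))
       (Ab : Action Gb Yb) (φ : Carrier Gb → Carrier G) : Set where
  open FinGroup G using (_∙_)
  field
    ΨV : Carrier G → Fin (nV Yb) → Fin (nV Y)
    ΨE : Carrier G → Fin (nE Yb) → Fin (nE Y)
    ΨV-fib  : ∀ g α → fV f (ΨV g α) ≡ b
    ΨE-fib  : ∀ g ε → fE f (ΨE g ε) ≡ inj₂ b
    ΨV-surj : ∀ y → fV f y ≡ b → ∃₂ λ g α → ΨV g α ≡ y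
    ΨE-surj : ∀ e → fE f e ≡ inj₂ b → ∃₂ λ g ε → ΨE g ε ≡ e
    ΨV-ker₁ : ∀ g α g' α' → ΨV g α ≡ ΨV g' α' →
              ∃ λ h → (g ≡ g' ∙ φ h) × (α' ≡ actV Ab h α)
    ΨV-ker₂ : ∀ g α g' α' h → g ≡ g' ∙ φ h → α' ≡ actV Ab h α →
              ΨV g α ≡ ΨV g' α'
    ΨE-ker₁ : ∀ g ε g' ε' → ΨE g ε ≡ ΨE g' ε' →
              ∃ λ h → (g ≡ g' ∙ φ h) × (ε' ≡ actE Ab h ε)
    ΨE-ker₂ : ∀ g ε g' ε' h → g ≡ g' ∙ φ h → ε' ≡ actE Ab h ε →
              ΨE g ε ≡ ΨE g' ε'
    ΨV-equiv : ∀ k g α → actV A k (ΨV g α) ≡ ΨV (k ∙ g) α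
    ΨE-equiv : ∀ k g ε → actE A k (ΨE g ε) ≡ ΨE (k ∙ g) ε
    Ψ-ends   : ∀ g ε → HasEnds Y (ΨE g ε) (ΨV g (src Yb ε)) (ΨV g (tgt Yb ε))

-- Choose a spanning tree of X. Its complement has exactly genus X edges, so the γᵢ can be placed on
-- them and the identity on the tree edges, giving an edge labelling w. Over each vertex v take the
-- induced cover G ×_{G_v} Y_v (a trivial group acting on a point when v ∉ B) and lift every edge e of
-- X to the edges (e , g), g ∈ G, from ⟦g , ζ⟧ over src e to ⟦g w(e) , ζ⟧ over tgt e; G acts by left
-- translation. The quotient is X and the fibres are the induced covers by construction; no edge has a
-- nontrivial stabiliser, which makes every quotient map harmonic. For connectivity, the g whose sheet
-- ⟦g , ζ⟧ is joined to the sheet of the identity form a subgroup, which contains each φ_b(G_b) (through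
-- the connected fibre copy of Y_b) and each γᵢ (through the lifts of the tree and of the i-th cotree
-- edge), hence is all of G.

module Submission where

open import Defs
open import Level using (0ℓ)
open import Data.Nat using (ℕ; zero; suc; _+_; _*_; _∸_; _≤_; z≤n; s≤s; >-nonZero⁻¹)
open import Data.Nat.Properties using (≤-antisym; ≤-trans; n≤1+n; <-irrefl; +-suc; +-comm; +-identityʳ; m+[n∸m]≡n; m+n∸n≡m)
open import Data.Fin using (Fin; zero; suc; _≟_; fromℕ<)
open import Data.Fin.Properties using (+↔⊎; *↔×; 0↔⊥; 1↔⊤; injective⇒≤; any?; suc-injective; nonZeroIndex)
open import Data.Fin.Subset using (Subset; _∈_)
open import Data.Fin.Subset.Properties using (_∈?_)
open import Data.Vec.Properties.WithK using ([]=-irrelevant)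
open import Data.Sum using (_⊎_; inj₁; inj₂)
open import Data.Sum.Properties using (inj₁-injective; inj₂-injective)
open import Data.Sum.Function.Propositional using (_⊎-↔_)
open import Data.Product using (Σ; ∃; ∃₂; _×_; _,_; proj₁; proj₂; map)
open import Data.Product.Properties using (,-injectiveʳ-UIP)
open import Data.Product.Function.NonDependent.Propositional using (_×-↔_)
open import Data.Bool using (Bool; true; false; _∧_; _xor_; not; if_then_else_)
open import Data.Bool.Properties using () renaming (_≟_ to _≟ᵇ_)
open import Data.Maybe using (Maybe; just; nothing; maybe′)
import Data.Maybe as Maybe
open import Data.Empty using (⊥)
open import Data.Unit using (⊤; tt)
open import Function using (_∘_)
open import Function.Bundles using (Inverse; _↔_; mk↔ₛ′)
open import Function.Properties.Inverse using (↔-refl; ↔-sym; ↔-trans)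
open import Algebra.Bundles using (Group)
open import Algebra.Structures using (IsGroup)
open import Algebra.Morphism.Structures using (module GroupMorphisms)
open import Axiom.UniquenessOfIdentityProofs using (module Decidable⇒UIP)
open import Relation.Nullary using (Dec; yes; no; does; ¬_; contradiction)
open import Relation.Nullary.Decidable using (dec-true; _×-dec_)
open import Relation.Binary.Structures using (IsEquivalence)
open import Relation.Binary.PropositionalEquality
  using (_≡_; _≢_; refl; sym; trans; cong; cong₂; subst; subst₂; isEquivalence; module ≡-Reasoning)
open import Relation.Binary.PropositionalEquality.Properties using (subst-sym-subst)
open import Relation.Binary.Construct.Closure.ReflexiveTransitive using (Star; _◅_; _◅◅_; gmap; reverse)
  renaming (ε to [])

-- Finite types and quotients by decidable equivalences

record Finite (A : Set) : Set where
  field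
    size : ℕ
    enum : A ↔ Fin size
  open Inverse enum public using (to; from)
    renaming (strictlyInverseˡ to to-from; strictlyInverseʳ to from-to)

  to-injective : ∀ {a b} → to a ≡ to b → a ≡ b
  to-injective {a} {b} e = trans (sym (from-to a)) (trans (cong from e) (from-to b))
open Finite public

finite-Fin : ∀ n → Finite (Fin n)
finite-Fin n = record { size = n ; enum = ↔-refl }

finite-⊎ : ∀ {A B} → Finite A → Finite B → Finite (A ⊎ B)
finite-⊎ FA FB = record { size = size FA + size FB ; enum = ↔-trans (enum FA ⊎-↔ enum FB) (↔-sym +↔⊎) }

finite-× : ∀ {A B} → Finite A → Finite B → Finite (A × B)
finite-× FA FB = record { size = size FA * size FB ; enum = ↔-trans (enum FA ×-↔ enum FB) (↔-sym *↔×) }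

Σ-Fin-suc↔ : ∀ {n} {B : Fin (suc n) → Set} → Σ (Fin (suc n)) B ↔ (B zero ⊎ Σ (Fin n) (λ i → B (suc i)))
Σ-Fin-suc↔ = mk↔ₛ′ split join (λ { (inj₁ _) → refl ; (inj₂ _) → refl }) (λ { (zero , _) → refl ; (suc _ , _) → refl })
  where
  split : ∀ {n} {B : Fin (suc n) → Set} → Σ (Fin (suc n)) B → B zero ⊎ Σ (Fin n) (λ i → B (suc i))
  split (zero , b) = inj₁ b
  split (suc i , b) = inj₂ (i , b)
  join : ∀ {n} {B : Fin (suc n) → Set} → B zero ⊎ Σ (Fin n) (λ i → B (suc i)) → Σ (Fin (suc n)) B
  join (inj₁ b) = zero , b
  join (inj₂ (i , b)) = suc i , b

finite-Σ : ∀ n {B : Fin n → Set} → (∀ i → Finite (B i)) → Finite (Σ (Fin n) B)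
finite-Σ zero F = record { size = 0 ; enum = ↔-trans (mk↔ₛ′ (λ { (() , _) }) (λ ()) (λ ()) (λ { (() , _) })) (↔-sym 0↔⊥) }
finite-Σ (suc n) F = record { size = size S ; enum = ↔-trans Σ-Fin-suc↔ (enum S) }
  where S = finite-⊎ (F zero) (finite-Σ n (λ i → F (suc i)))

finite-≡true : ∀ b → Finite (b ≡ true)
finite-≡true true = record { size = 1 ; enum = ↔-trans (mk↔ₛ′ (λ _ → tt) (λ _ → refl) (λ _ → refl) (≡-irrelevant refl)) (↔-sym 1↔⊤) }
  where open Decidable⇒UIP _≟ᵇ_
finite-≡true false = record { size = 0 ; enum = ↔-trans (mk↔ₛ′ (λ ()) (λ ()) (λ ()) (λ ())) (↔-sym 0↔⊥) }

Satisfying : ∀ {n} → (Fin n → Bool) → Set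
Satisfying {n} p = Σ (Fin n) (λ i → p i ≡ true)

finite-Satisfying : ∀ {n} (p : Fin n → Bool) → Finite (Satisfying p)
finite-Satisfying {n} p = finite-Σ n (λ i → finite-≡true (p i))

size-finite-Satisfying : ∀ {n} (p : Fin n → Bool) → size (finite-Satisfying p) ≡ count p
size-finite-Satisfying {zero} p = refl
size-finite-Satisfying {suc n} p with p zero
... | true = cong suc (size-finite-Satisfying (p ∘ suc))
... | false = size-finite-Satisfying (p ∘ suc)

Satisfying-≡ : ∀ {n} {p : Fin n → Bool} {x y : Satisfying p} → proj₁ x ≡ proj₁ y → x ≡ y
Satisfying-≡ {x = i , px} {.i , py} refl = cong (i ,_) (≡-irrelevant px py)
  where open Decidable⇒UIP _≟ᵇ_

count-≤-injection : ∀ {n m} (p : Fin n → Bool) (q : Fin m → Bool) (f : Satisfying p → Satisfying q) →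
                    (∀ x y → proj₁ (f x) ≡ proj₁ (f y) → proj₁ x ≡ proj₁ y) → count p ≤ count q
count-≤-injection p q f f-inj =
  subst₂ _≤_ (size-finite-Satisfying p) (size-finite-Satisfying q) (injective⇒≤ {f = f′} f′-inj)
  where
  P = finite-Satisfying p
  Q = finite-Satisfying q
  f′ : Fin (size P) → Fin (size Q)
  f′ k = to Q (f (from P k))
  f′-inj : ∀ {k l} → f′ k ≡ f′ l → k ≡ l
  f′-inj {k} {l} e = trans (sym (to-from P k))
    (trans (cong (to P) (Satisfying-≡ (f-inj _ _ (cong proj₁ (to-injective Q e))))) (to-from P l))

count-≡-bijection : ∀ {n} (p q : Fin n → Bool) (f : Satisfying p → Satisfying q) (g : Satisfying q → Satisfying p) →
                    (∀ x y → proj₁ (f x) ≡ proj₁ (f y) → proj₁ x ≡ proj₁ y) →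
                    (∀ x y → proj₁ (g x) ≡ proj₁ (g y) → proj₁ x ≡ proj₁ y) → count p ≡ count q
count-≡-bijection p q f g f-inj g-inj = ≤-antisym (count-≤-injection p q f f-inj) (count-≤-injection q p g g-inj)

first : ∀ {n} → (Fin n → Bool) → Maybe (Fin n)
first {zero} p = nothing
first {suc n} p = if p zero then just zero else Maybe.map suc (first (p ∘ suc))

first-cong : ∀ {n} {p q : Fin n → Bool} → (∀ i → p i ≡ q i) → first p ≡ first q
first-cong {zero} e = refl
first-cong {suc n} {p} {q} e rewrite e zero | first-cong {p = p ∘ suc} {q = q ∘ suc} (e ∘ suc) = refl

first-sound : ∀ {n} (p : Fin n → Bool) {j} → first p ≡ just j → p j ≡ true
first-sound {suc n} p {j} e with p zero in p0 | first (p ∘ suc) in rest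
first-sound {suc n} p refl | true | _ = p0
first-sound {suc n} p refl | false | just j = first-sound (p ∘ suc) rest

first-complete : ∀ {n} (p : Fin n → Bool) {i} → p i ≡ true → ∃ λ j → first p ≡ just j
first-complete {suc n} p {i} pi with p zero in p0
... | true = zero , refl
first-complete {suc n} p {zero} pi | false = contradiction (trans (sym p0) pi) λ ()
first-complete {suc n} p {suc i} pi | false with first-complete (p ∘ suc) pi
... | j , e rewrite e = suc j , refl

does-true⇒ : ∀ {P : Set} (d : Dec P) → does d ≡ true → P
does-true⇒ (yes p) _ = p

does-cong : ∀ {P Q : Set} → (P → Q) → (Q → P) → (d : Dec P) (d′ : Dec Q) → does d ≡ does d′
does-cong f g (yes p) (yes q) = refl
does-cong f g (yes p) (no ¬q) = contradiction (f p) ¬q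
does-cong f g (no ¬p) (yes q) = contradiction (g q) ¬p
does-cong f g (no ¬p) (no ¬q) = refl

-- Classes are represented by their first element in the enumeration of A.
module FiniteQuotient {A : Set} (FA : Finite A) {R : A → A → Set}
                      (R? : ∀ a b → Dec (R a b)) (R-equiv : IsEquivalence R) where
  open IsEquivalence R-equiv renaming (refl to R-refl; sym to R-sym; trans to R-trans)

  private
    relatedTo : A → Fin (size FA) → Bool
    relatedTo a i = does (R? (from FA i) a)

    relatedTo-self : ∀ a → relatedTo a (to FA a) ≡ true
    relatedTo-self a = dec-true (R? _ a) (subst (λ x → R x a) (sym (from-to FA a)) R-refl)

    canon : A → A
    canon a = maybe′ (from FA) a (first (relatedTo a))

    canon-R : ∀ a → R (canon a) a
    canon-R a with first-complete (relatedTo a) (relatedTo-self a)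
    ... | j , e rewrite e = does-true⇒ (R? (from FA j) a) (first-sound (relatedTo a) e)

    canon-cong : ∀ {a b} → R a b → canon a ≡ canon b
    canon-cong {a} {b} r with first-complete (relatedTo a) (relatedTo-self a)
    ... | j , e = begin
      maybe′ (from FA) a (first (relatedTo a)) ≡⟨ cong (maybe′ (from FA) a) e ⟩
      from FA j                                ≡⟨ cong (maybe′ (from FA) b) (trans (sym e) (first-cong same)) ⟩
      maybe′ (from FA) b (first (relatedTo b)) ∎
      where
      open ≡-Reasoning
      same : ∀ i → relatedTo a i ≡ relatedTo b i
      same i = does-cong (λ x → R-trans x r) (λ x → R-trans x (R-sym r)) (R? _ a) (R? _ b)

  isCanonical : Fin (size FA) → Bool
  isCanonical i = does (to FA (canon (from FA i)) ≟ i)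

  Q : Set
  Q = Satisfying isCanonical

  finite-Q : Finite Q
  finite-Q = finite-Satisfying isCanonical

  abstract
    rep : Q → A
    rep (i , _) = from FA i

    [_] : A → Q
    [ a ] = to FA (canon a) , dec-true (_ ≟ _) (cong (to FA) (trans (cong canon (from-to FA (canon a))) (canon-cong (canon-R a))))

    rep-[] : ∀ a → R (rep [ a ]) a
    rep-[] a = subst (λ x → R x a) (sym (from-to FA (canon a))) (canon-R a)

    []-cong : ∀ {a b} → R a b → [ a ] ≡ [ b ]
    []-cong r = Satisfying-≡ (cong (to FA) (canon-cong r))

    []-exact : ∀ {a b} → [ a ] ≡ [ b ] → R a b
    []-exact {a} {b} e = R-trans (R-sym (rep-[] a)) (subst (λ q → R (rep q) b) (sym e) (rep-[] b))

    []-rep : ∀ q → [ rep q ] ≡ q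
    []-rep (i , c) = Satisfying-≡ (does-true⇒ (_ ≟ i) c)

group : FinGroup → Group 0ℓ 0ℓ
group G = record { FinGroup G }

module GroupProperties (G : FinGroup) where
  open Group (group G) public using (_∙_; ε; _⁻¹; _//_; assoc; identityˡ; identityʳ; inverseˡ; inverseʳ)
  open import Algebra.Properties.Group (group G) public
    using (∙-cancelˡ; identityˡ-unique; identityʳ-unique; //-rightDividesˡ; //-rightDividesʳ; ε⁻¹≈ε)

module Embedding (H G : FinGroup) {φ : Carrier H → Carrier G} (emb : IsEmbedding H G φ) where
  open GroupMorphisms.IsGroupMonomorphism emb public using (injective; ε-homo; ⁻¹-homo; ∙-homo)

  trivial-kernel : ∀ h → φ h ≡ FinGroup.ε G → h ≡ FinGroup.ε H
  trivial-kernel h e = injective (trans e (sym ε-homo))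

Generated-minimal : ∀ {G S P} → IsSubgroup G P → (∀ {x} → S x → P x) → ∀ {x} → Generated G S x → P x
Generated-minimal sub S⊆P (gen s) = S⊆P s
Generated-minimal sub S⊆P unit = IsSubgroup.ε-mem sub
Generated-minimal sub S⊆P (mul a b) = IsSubgroup.∙-mem sub (Generated-minimal sub S⊆P a) (Generated-minimal sub S⊆P b)
Generated-minimal sub S⊆P (inv a) = IsSubgroup.⁻¹-mem sub (Generated-minimal sub S⊆P a)

Generated-isSubgroup : ∀ {G S} → IsSubgroup G (Generated G S)
Generated-isSubgroup = record { ε-mem = unit ; ∙-mem = mul ; ⁻¹-mem = inv }

-- The relation (g φ(h), α) ∼ (g, h α) whose classes are the elements of G ×_H Z.
module InducedRelation (G H : FinGroup) {φ : Carrier H → Carrier G} (emb : IsEmbedding H G φ)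
  {n : ℕ} (act : Carrier H → Fin n → Fin n)
  (act-ε : ∀ α → act (FinGroup.ε H) α ≡ α)
  (act-∙ : ∀ h h′ α → act (FinGroup._∙_ H h h′) α ≡ act h (act h′ α)) where
  private
    module G = GroupProperties G
    module H = GroupProperties H
  open G using (_∙_)
  open Embedding H G emb

  infix 4 _∼_
  _∼_ : Carrier G × Fin n → Carrier G × Fin n → Set
  (g , α) ∼ (g′ , α′) = ∃ λ h → (g ≡ g′ ∙ φ h) × (α′ ≡ act h α)

  _∼?_ : ∀ x y → Dec (x ∼ y)
  (g , α) ∼? (g′ , α′) = any? (λ h → (g ≟ g′ ∙ φ h) ×-dec (α′ ≟ act h α))

  ∼-isEquivalence : IsEquivalence _∼_
  ∼-isEquivalence = record { refl = ∼-refl ; sym = ∼-sym ; trans = ∼-trans }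
    where
    ∼-refl : ∀ {x} → x ∼ x
    ∼-refl {g , α} = H.ε , sym (trans (cong (g ∙_) ε-homo) (G.identityʳ g)) , sym (act-ε α)
    ∼-sym : ∀ {x y} → x ∼ y → y ∼ x
    ∼-sym {g , α} {g′ , α′} (h , e₁ , e₂) = h H.⁻¹ ,
      sym (trans (cong (g ∙_) (⁻¹-homo h)) (trans (cong (G._// φ h) e₁) (G.//-rightDividesʳ (φ h) g′))) ,
      sym (trans (cong (act (h H.⁻¹)) e₂) (trans (sym (act-∙ _ _ α)) (trans (cong (λ k → act k α) (H.inverseˡ h)) (act-ε α))))
    ∼-trans : ∀ {x y z} → x ∼ y → y ∼ z → x ∼ z
    ∼-trans {g , α} {g′ , α′} {g″ , α″} (h , e₁ , e₂) (h′ , e₃ , e₄) = h′ H.∙ h ,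
      trans e₁ (trans (cong (_∙ φ h) e₃) (trans (G.assoc _ _ _) (cong (g″ ∙_) (sym (∙-homo h′ h))))) ,
      trans e₄ (trans (cong (act h′) e₂) (sym (act-∙ h′ h α)))

  ∼-translate : ∀ k {g α g′ α′} → (g , α) ∼ (g′ , α′) → (k ∙ g , α) ∼ (k ∙ g′ , α′)
  ∼-translate k (h , e₁ , e₂) = h , trans (cong (k ∙_) e₁) (sym (G.assoc _ _ _)) , e₂

  ∼-φ : ∀ g h α → (g ∙ φ h , α) ∼ (g , act h α)
  ∼-φ g h α = h , refl , refl

  ∼-sameGroupElement : ∀ g {α α′} → (g , α) ∼ (g , α′) → ∃ λ h → (φ h ≡ G.ε) × (α′ ≡ act h α)
  ∼-sameGroupElement g (h , e₁ , e₂) = h , G.identityʳ-unique g (φ h) (sym e₁) , e₂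

-- Graphs, and harmonicity of unflipped actions

HasEnds-sym : ∀ {Y e a b} → HasEnds Y e a b → HasEnds Y e b a
HasEnds-sym (inj₁ (p , q)) = inj₂ (p , q)
HasEnds-sym (inj₂ (p , q)) = inj₁ (p , q)

HasEnds-image : ∀ {Y X} (f : Fin (nV Y) → Fin (nV X)) {e e′ a b} →
                HasEnds X e′ (f (src Y e)) (f (tgt Y e)) → HasEnds Y e a b → HasEnds X e′ (f a) (f b)
HasEnds-image f h (inj₁ (refl , refl)) = h
HasEnds-image {X = X} f {e′ = e′} h (inj₂ (refl , refl)) = HasEnds-sym {X} {e′} h

HasEnds-distinct : ∀ {Y e a b} → HasEnds Y e a b → a ≢ b
HasEnds-distinct {Y} {e} (inj₁ (refl , refl)) = noLoop Y e
HasEnds-distinct {Y} {e} (inj₂ (refl , refl)) = noLoop Y e ∘ sym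

HasEnds⇒Incident : ∀ {Y e a b} → HasEnds Y e a b → Incident Y a e
HasEnds⇒Incident (inj₁ (p , _)) = inj₁ p
HasEnds⇒Incident (inj₂ (_ , p)) = inj₂ p

Incident⇒HasEnds : ∀ {Y v e} → Incident Y v e → ∃ λ w → HasEnds Y e v w
Incident⇒HasEnds {Y} {e = e} (inj₁ p) = tgt Y e , inj₁ (p , refl)
Incident⇒HasEnds {Y} {e = e} (inj₂ p) = src Y e , inj₂ (refl , p)

Incident-HasEnds : ∀ {Y e a b v} → HasEnds Y e a b → Incident Y v e → v ≡ a ⊎ v ≡ b
Incident-HasEnds (inj₁ (refl , _)) (inj₁ refl) = inj₁ refl
Incident-HasEnds (inj₁ (_ , refl)) (inj₂ refl) = inj₂ refl
Incident-HasEnds (inj₂ (refl , _)) (inj₁ refl) = inj₂ refl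
Incident-HasEnds (inj₂ (_ , refl)) (inj₂ refl) = inj₁ refl

incident?⇒Incident : ∀ Y v e → incident? Y v e ≡ true → Incident Y v e
incident?⇒Incident Y v e h with src Y e ≟ v | tgt Y e ≟ v
... | yes p | _ = inj₁ p
... | no _ | yes p = inj₂ p

Incident⇒incident? : ∀ Y v e → Incident Y v e → incident? Y v e ≡ true
Incident⇒incident? Y v e i with src Y e ≟ v | tgt Y e ≟ v
... | yes _ | _ = refl
... | no _ | yes _ = refl
Incident⇒incident? Y v e (inj₁ p) | no ¬p | no _ = contradiction p ¬p
Incident⇒incident? Y v e (inj₂ p) | no _ | no ¬p = contradiction p ¬p

mapsTo?⇒fE : ∀ {Y X} (f : Morphism Y X) e e′ → mapsTo? f e e′ ≡ true → fE f e ≡ inj₁ e′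
mapsTo?⇒fE f e e′ h with fE f e
... | inj₁ e″ = cong inj₁ (does-true⇒ (e″ ≟ e′) h)

fE⇒mapsTo? : ∀ {Y X} (f : Morphism Y X) e e′ → fE f e ≡ inj₁ e′ → mapsTo? f e e′ ≡ true
fE⇒mapsTo? f e e′ h with fE f e
fE⇒mapsTo? f e e′ refl | inj₁ .e′ = dec-true (e′ ≟ e′) refl

∧-≡true⇒ : ∀ {a b} → a ∧ b ≡ true → a ≡ true × b ≡ true
∧-≡true⇒ {true} {true} _ = refl , refl

≡true⇒∧ : ∀ {a b} → a ≡ true → b ≡ true → a ∧ b ≡ true
≡true⇒∧ refl refl = refl

module _ {G : FinGroup} {Y : Graph} (A : Action G Y) where
  open GroupProperties G

  actE-HasEnds : ∀ g {e a b} → HasEnds Y e a b → HasEnds Y (actE A g e) (actV A g a) (actV A g b)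
  actE-HasEnds g {e} = HasEnds-image {Y} {Y} (actV A g) {e} (act-ends A g e)

  actE-Incident : ∀ g {v e} → Incident Y v e → Incident Y (actV A g v) (actE A g e)
  actE-Incident g {v} {e} i = HasEnds⇒Incident {Y} (actE-HasEnds g (proj₂ (Incident⇒HasEnds {Y} {v} {e} i)))

  actE-inverse : ∀ g e → actE A (g ⁻¹) (actE A g e) ≡ e
  actE-inverse g e = trans (sym (actE-∙ A _ _ e)) (trans (cong (λ k → actE A k e) (inverseˡ g)) (actE-ε A e))

  Unflipped⇒actE-injectiveˡ : Unflipped A → ∀ g h e → actE A g e ≡ actE A h e → g ≡ h
  Unflipped⇒actE-injectiveˡ unflipped g h e eq = ∙-cancelˡ (h ⁻¹) g h (trans fixes (sym (inverseˡ h)))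
    where
    fixes : h ⁻¹ ∙ g ≡ ε
    fixes = unflipped _ e (trans (actE-∙ A _ _ e) (trans (cong (actE A (h ⁻¹)) eq) (actE-inverse h e)))

-- The edges of y(1) over e₁ are carried bijectively onto those over e₂ by the elements of H taking
-- one fixed edge over e₁ to the others: these elements fix y, and, the action being free on edges,
-- applying them to a fixed edge over e₂ is injective.
Unflipped⇒quotient-harmonic : ∀ {G Y Z} (A : Action G Y) → Unflipped A →
  ∀ {H : Carrier G → Set} {q : Morphism Y Z} → IsQuotientBy A H q → IsHarmonic q
Unflipped⇒quotient-harmonic {G} {Y} {Z} A unflipped {H} {q} quot y e₁ e₂ i₁ i₂ =
  count-≡-bijection (over e₁) (over e₂) (transfer x₁ x₂) (transfer x₂ x₁)
    (transfer-injective x₁ x₂) (transfer-injective x₂ x₁)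
  where
  open IsQuotientBy quot

  over : Fin (nE Z) → Fin (nE Y) → Bool
  over e′ e = incident? Y y e ∧ mapsTo? q e e′

  module _ {e′} (x : Satisfying (over e′)) where
    incidentAt : Incident Y y (proj₁ x)
    incidentAt = incident?⇒Incident Y y _ (proj₁ (∧-≡true⇒ (proj₂ x)))

    liesOver : fE q (proj₁ x) ≡ inj₁ e′
    liesOver = mapsTo?⇒fE q _ e′ (proj₂ (∧-≡true⇒ (proj₂ x)))

  edgeOver-ends : ∀ {e e′} → fE q e ≡ inj₁ e′ → HasEnds Z e′ (fV q (src Y e)) (fV q (tgt Y e))
  edgeOver-ends {e} {e′} = edge-ok q e e′

  translateTo-y : ∀ {d e′ v} → fE q d ≡ inj₁ e′ → Incident Y v d → fV q v ≡ fV q y → Satisfying (over e′)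
  translateTo-y {d} {e′} {v} fd iv eq with V-ker₁ v y eq
  ... | h , hH , refl = actE A h d ,
    ≡true⇒∧ (Incident⇒incident? Y _ _ (actE-Incident A h {v} {d} iv)) (fE⇒mapsTo? q _ e′ (E-ker₂ d _ e′ h fd hH refl))

  edgeAt : ∀ e′ → Incident Z (fV q y) e′ → Satisfying (over e′)
  edgeAt e′ inc with E-surj e′
  ... | d , fd with Incident-HasEnds {Z} (edgeOver-ends fd) inc
  ... | inj₁ e = translateTo-y fd (inj₁ refl) (sym e)
  ... | inj₂ e = translateTo-y fd (inj₂ refl) (sym e)

  x₁ = edgeAt e₁ i₁
  x₂ = edgeAt e₂ i₂

  -- Otherwise h would swap the ends of e₀, which are identified in Z since h ∈ H, making e′ a loop.
  fixesVertex : ∀ {e′ e₀ e h} → H h → Incident Y y e₀ → fE q e₀ ≡ inj₁ e′ → Incident Y y e →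
                actE A h e₀ ≡ e → actV A h y ≡ y
  fixesVertex {e′} {e₀} {h = h} hH i₀ f₀ i refl with Incident⇒HasEnds {Y} i₀
  ... | w , ends with Incident-HasEnds {Y} (actE-HasEnds A h {e₀} ends) i
  ... | inj₁ hy = sym hy
  ... | inj₂ hw = contradiction (trans (V-ker₂ w _ h hH refl) (cong (fV q) (sym hw)))
                    (HasEnds-distinct {Z} (HasEnds-image {Y} {Z} (fV q) {e₀} (edgeOver-ends f₀) ends) ∘ sym)

  mover : ∀ {e′} (x₀ x : Satisfying (over e′)) → ∃ λ h → H h × actE A h (proj₁ x₀) ≡ proj₁ x
  mover x₀ x = E-ker₁ _ _ _ (liesOver x₀) (liesOver x)

  transfer : ∀ {e′ e″} → Satisfying (over e′) → Satisfying (over e″) → Satisfying (over e′) → Satisfying (over e″)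
  transfer {e″ = e″} x₀ (f₀ , p₀) x with mover x₀ x
  ... | h , hH , moves = actE A h f₀ ,
    ≡true⇒∧ (Incident⇒incident? Y y _ (subst (λ v → Incident Y v (actE A h f₀))
                                              (fixesVertex hH (incidentAt x₀) (liesOver x₀) (incidentAt x) moves)
                                              (actE-Incident A h {y} {f₀} (incidentAt (f₀ , p₀)))))
            (fE⇒mapsTo? q _ e″ (E-ker₂ f₀ _ e″ h (liesOver (f₀ , p₀)) hH refl))

  transfer-injective : ∀ {e′ e″} (x₀ : Satisfying (over e′)) (f₀ : Satisfying (over e″)) x x′ →
                       proj₁ (transfer x₀ f₀ x) ≡ proj₁ (transfer x₀ f₀ x′) → proj₁ x ≡ proj₁ x′
  transfer-injective x₀ f₀ x x′ eq with mover x₀ x | mover x₀ x′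
  ... | h , _ , refl | h′ , _ , refl =
    cong (λ k → actE A k (proj₁ x₀)) (Unflipped⇒actE-injectiveˡ A unflipped h h′ (proj₁ f₀) eq)

Unflipped⇒HarmonicAction : ∀ {G Y} (A : Action G Y) → Unflipped A → HarmonicAction A
Unflipped⇒HarmonicAction A unflipped _ _ _ _ quotient = Unflipped⇒quotient-harmonic A unflipped quotient

-- Spanning trees

count-cong : ∀ {n} {p q : Fin n → Bool} → (∀ i → p i ≡ q i) → count p ≡ count q
count-cong {zero} e = refl
count-cong {suc n} e rewrite e zero = cong (_ +_) (count-cong (e ∘ suc))

count-≤ : ∀ {n} (p : Fin n → Bool) → count p ≤ n
count-≤ {zero} p = z≤n
count-≤ {suc n} p with p zero
... | true = s≤s (count-≤ (p ∘ suc))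
... | false = ≤-trans (count-≤ (p ∘ suc)) (n≤1+n n)

count-const-false : ∀ n → count {n} (λ _ → false) ≡ 0
count-const-false zero = refl
count-const-false (suc n) = count-const-false n

count-const-true : ∀ {n} (p : Fin n → Bool) → (∀ i → p i ≡ true) → count p ≡ n
count-const-true {zero} p all = refl
count-const-true {suc n} p all rewrite all zero = cong suc (count-const-true (p ∘ suc) (all ∘ suc))

count-complement : ∀ {n} (p : Fin n → Bool) → count p + count (not ∘ p) ≡ n
count-complement {zero} p = refl
count-complement {suc n} p with p zero
... | true = cong suc (count-complement (p ∘ suc))
... | false = trans (+-suc (count (p ∘ suc)) _) (cong suc (count-complement (p ∘ suc)))

insert : ∀ {n} → (Fin n → Bool) → Fin n → Fin n → Bool
insert p i j = if does (j ≟ i) then true else p j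

insert-here : ∀ {n} (p : Fin n → Bool) i → insert p i i ≡ true
insert-here p i with i ≟ i
... | yes _ = refl
... | no i≢i = contradiction refl i≢i

insert-there : ∀ {n} (p : Fin n → Bool) i {j} → p j ≡ true → insert p i j ≡ true
insert-there p i {j} pj with j ≟ i
... | yes _ = refl
... | no _ = pj

insert-cases : ∀ {n} (p : Fin n → Bool) i {j} → insert p i j ≡ true → j ≡ i ⊎ p j ≡ true
insert-cases p i {j} h with j ≟ i
... | yes e = inj₁ e
... | no _ = inj₂ h

count-insert : ∀ {n} (p : Fin n → Bool) i → p i ≡ false → count (insert p i) ≡ suc (count p)
count-insert {suc n} p zero p0 rewrite p0 = refl
count-insert {suc n} p (suc i) pi =
  trans (cong (_ +_) (trans (count-cong insert-suc) (count-insert (p ∘ suc) i pi))) (+-suc _ _)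
  where
  insert-suc : ∀ j → insert p (suc i) (suc j) ≡ insert (p ∘ suc) i j
  insert-suc j with j ≟ i | suc j ≟ suc i
  ... | yes _ | yes _ = refl
  ... | no _ | no _ = refl
  ... | yes refl | no ne = contradiction refl ne
  ... | no ne | yes e = contradiction (suc-injective e) ne

Star-empty : ∀ {A : Set} {R : A → A → Set} → (∀ {a b} → ¬ R a b) → ∀ {a b} → Star R a b → a ≡ b
Star-empty ¬R [] = refl
Star-empty ¬R (r ◅ _) = contradiction r ¬R

TreeAdj : (X : Graph) → (Fin (nE X) → Bool) → Fin (nV X) → Fin (nV X) → Set
TreeAdj X T a b = ∃ λ e → T e ≡ true × HasEnds X e a b

record SpanningTree (X : Graph) : Set where
  field
    root : Fin (nV X)
    inTree : Fin (nE X) → Bool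
    reaches : ∀ v → Star (TreeAdj X inTree) root v
    edgeCount : suc (count inTree) ≡ nV X

module SpanningTreeConstruction (X : Graph) (conn : Connected X) where
  root : Fin (nV X)
  root = fromℕ< (proj₁ conn)

  record Subtree : Set where
    field
      S : Fin (nV X) → Bool
      T : Fin (nE X) → Bool
      root∈S : S root ≡ true
      reaches : ∀ v → S v ≡ true → Star (TreeAdj X T) root v
      edgeCount : suc (count T) ≡ count S
      src∈S : ∀ e → T e ≡ true → S (src X e) ≡ true
      tgt∈S : ∀ e → T e ≡ true → S (tgt X e) ≡ true

  seed : Subtree
  seed = record
    { S = insert (λ _ → false) root ; T = λ _ → false ; root∈S = insert-here _ root
    ; reaches = reaches
    ; edgeCount = sym (trans (count-insert (λ _ → false) root refl)
                             (cong suc (trans (count-const-false (nV X)) (sym (count-const-false (nE X))))))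
    ; src∈S = λ _ () ; tgt∈S = λ _ () }
    where
    reaches : ∀ v → insert (λ _ → false) root v ≡ true → Star (TreeAdj X (λ _ → false)) root v
    reaches v s with insert-cases (λ _ → false) root {v} s
    ... | inj₁ refl = []

  leaves : (Fin (nV X) → Bool) → Fin (nE X) → Bool
  leaves S e = S (src X e) xor S (tgt X e)

  leaves⇒ends : ∀ S e → leaves S e ≡ true → ∃₂ λ a b → HasEnds X e a b × S a ≡ true × S b ≡ false
  leaves⇒ends S e h with S (src X e) in s | S (tgt X e) in t
  ... | true | false = src X e , tgt X e , inj₁ (refl , refl) , s , t
  ... | false | true = tgt X e , src X e , inj₂ (refl , refl) , t , s

  ends⇒leaves : ∀ S {e a b} → HasEnds X e a b → S a ≡ true → S b ≡ false → leaves S e ≡ true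
  ends⇒leaves S (inj₁ (refl , refl)) sa sb rewrite sa | sb = refl
  ends⇒leaves S (inj₂ (refl , refl)) sa sb rewrite sa | sb = refl

  module _ (t : Subtree) where
    open Subtree t

    tree-ends∈S : ∀ {e a b} → T e ≡ true → HasEnds X e a b → S a ≡ true × S b ≡ true
    tree-ends∈S {e} te (inj₁ (refl , refl)) = src∈S e te , tgt∈S e te
    tree-ends∈S {e} te (inj₂ (refl , refl)) = tgt∈S e te , src∈S e te

    ends∈grown : ∀ {e a b} → HasEnds X e a b → S a ≡ true → ∀ {x} → x ≡ src X e ⊎ x ≡ tgt X e → insert S b x ≡ true
    ends∈grown (inj₁ (refl , refl)) sa (inj₁ refl) = insert-there S _ sa
    ends∈grown (inj₁ (refl , refl)) sa (inj₂ refl) = insert-here S _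
    ends∈grown (inj₂ (refl , refl)) sa (inj₁ refl) = insert-here S _
    ends∈grown (inj₂ (refl , refl)) sa (inj₂ refl) = insert-there S _ sa

    grow : ∀ {e a b} → HasEnds X e a b → S a ≡ true → S b ≡ false → Subtree
    grow {e} {a} {b} ends sa sb = record
      { S = insert S b ; T = insert T e ; root∈S = insert-there S b root∈S
      ; reaches = reaches′
      ; edgeCount = trans (cong suc (count-insert T e e∉T)) (trans (cong suc edgeCount) (sym (count-insert S b sb)))
      ; src∈S = λ e′ t′ → closed e′ t′ (src∈S e′) (inj₁ refl)
      ; tgt∈S = λ e′ t′ → closed e′ t′ (tgt∈S e′) (inj₂ refl) }
      where
      e∉T : T e ≡ false
      e∉T with T e in te
      ... | false = refl
      ... | true = contradiction (trans (sym (proj₂ (tree-ends∈S te ends))) sb) λ ()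
      widen : ∀ {u v} → Star (TreeAdj X T) u v → Star (TreeAdj X (insert T e)) u v
      widen = gmap (λ v → v) (λ { (e′ , t′ , h) → e′ , insert-there T e t′ , h })
      reaches′ : ∀ v → insert S b v ≡ true → Star (TreeAdj X (insert T e)) root v
      reaches′ v s with insert-cases S b {v} s
      ... | inj₁ refl = widen (reaches a sa) ◅◅ ((e , insert-here T e , ends) ◅ [])
      ... | inj₂ s′ = widen (reaches v s′)
      closed : ∀ e′ → insert T e e′ ≡ true → ∀ {x} → (T e′ ≡ true → S x ≡ true) →
               x ≡ src X e′ ⊎ x ≡ tgt X e′ → insert S b x ≡ true
      closed e′ t′ old x-end with insert-cases T e {e′} t′
      ... | inj₂ t″ = insert-there S b (old t″)
      ... | inj₁ refl = ends∈grown ends sa x-end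

    nothing-leaves⇒all : (∀ e → leaves S e ≢ true) → ∀ v → S v ≡ true
    nothing-leaves⇒all closedS v = along (proj₂ conn root v) root∈S
      where
      along : ∀ {a b} → Star (Adjacent X) a b → S a ≡ true → S b ≡ true
      along [] sa = sa
      along (_◅_ {j = c} (e , h) rest) sa with S c in sc
      ... | true = along rest sc
      ... | false = contradiction (ends⇒leaves S h sa sc) (closedS e)

  growAll : ∀ k (t : Subtree) → count (Subtree.S t) + k ≡ nV X → SpanningTree X
  growAll k t fuel with any? (λ e → leaves (Subtree.S t) e ≟ᵇ true)
  ... | no none = record
    { root = root ; inTree = Subtree.T t
    ; reaches = λ v → Subtree.reaches t v (all v)
    ; edgeCount = trans (Subtree.edgeCount t) (count-const-true _ all) }
    where all = nothing-leaves⇒all t (λ e l → none (e , l))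
  ... | yes (e , l) with leaves⇒ends (Subtree.S t) e l | k
  ...   | a , b , ends , sa , sb | suc k′ =
          growAll k′ (grow t ends sa sb) (trans (cong (_+ k′) (count-insert _ b sb)) (trans (sym (+-suc _ k′)) fuel))
  ...   | a , b , ends , sa , sb | zero =
          contradiction (subst (_≤ nV X) too-many (count-≤ (insert (Subtree.S t) b))) (<-irrefl refl)
    where
    too-many : count (insert (Subtree.S t) b) ≡ suc (nV X)
    too-many = trans (count-insert _ b sb) (cong suc (trans (sym (+-identityʳ _)) fuel))

  spanningTree : SpanningTree X
  spanningTree = growAll (nV X ∸ count (Subtree.S seed)) seed (m+[n∸m]≡n (count-≤ (Subtree.S seed)))

module Cotree {X : Graph} (t : SpanningTree X) where
  open SpanningTree t

  outside : Fin (nE X) → Bool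
  outside = not ∘ inTree

  private
    F = finite-Satisfying outside

    genus≡size : genus X ≡ size F
    genus≡size = begin
      nE X + 1 ∸ nV X                                    ≡⟨ cong₂ (λ m n → m + 1 ∸ n) (sym (count-complement inTree)) (sym edgeCount) ⟩
      count inTree + count outside + 1 ∸ suc (count inTree) ≡⟨ cong (_∸ suc (count inTree)) (reorder (count inTree) (count outside)) ⟩
      count outside + suc (count inTree) ∸ suc (count inTree) ≡⟨ m+n∸n≡m (count outside) (suc (count inTree)) ⟩
      count outside                                        ≡⟨ sym (size-finite-Satisfying outside) ⟩
      size F                                               ∎
      where
      open ≡-Reasoning
      reorder : ∀ a b → a + b + 1 ≡ b + suc a
      reorder a b = trans (+-comm (a + b) 1) (trans (cong suc (+-comm a b)) (sym (+-suc b a)))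

    index : Satisfying outside → Fin (genus X)
    index x = subst Fin (sym genus≡size) (to F x)

  cotreeEdge : Fin (genus X) → Fin (nE X)
  cotreeEdge i = proj₁ (from F (subst Fin genus≡size i))

  private
    labelBy : {A : Set} → A → (Fin (genus X) → A) → ∀ e b → inTree e ≡ b → A
    labelBy a₀ γ e true _ = a₀
    labelBy a₀ γ e false eq = γ (index (e , cong not eq))

  label : {A : Set} → A → (Fin (genus X) → A) → Fin (nE X) → A
  label a₀ γ e = labelBy a₀ γ e (inTree e) refl

  label-inTree : ∀ {A} (a₀ : A) γ {e} → inTree e ≡ true → label a₀ γ e ≡ a₀
  label-inTree a₀ γ {e} te = onTree (inTree e) refl te
    where
    onTree : ∀ b (eq : inTree e ≡ b) → b ≡ true → labelBy a₀ γ e b eq ≡ a₀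
    onTree true _ _ = refl

  label-cotreeEdge : ∀ {A} (a₀ : A) γ i → label a₀ γ (cotreeEdge i) ≡ γ i
  label-cotreeEdge a₀ γ i = offTree (inTree (cotreeEdge i)) refl
    where
    x = from F (subst Fin genus≡size i)
    offTree : ∀ b (eq : inTree (cotreeEdge i) ≡ b) → labelBy a₀ γ (cotreeEdge i) b eq ≡ γ i
    offTree true eq = contradiction (trans (sym (cong not eq)) (proj₂ x)) λ ()
    offTree false eq = cong γ (begin
      subst Fin (sym genus≡size) (to F (cotreeEdge i , cong not eq)) ≡⟨ cong (subst Fin (sym genus≡size) ∘ to F) (Satisfying-≡ refl) ⟩
      subst Fin (sym genus≡size) (to F x)                            ≡⟨ cong (subst Fin (sym genus≡size)) (to-from F _) ⟩
      subst Fin (sym genus≡size) (subst Fin genus≡size i)            ≡⟨ subst-sym-subst genus≡size ⟩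
      i                                                              ∎)
      where open ≡-Reasoning

-- The cover induced by a labelling of the edges and covers of the vertices

record EmbeddedPointCover (G : FinGroup) : Set where
  field
    H : FinGroup
    Z : Graph
    action : Action H Z
    φ : Carrier H → Carrier G
    φ-embedding : IsEmbedding H G φ
    basepoint : Fin (nV Z)
    transitive : ∀ α → ∃ λ h → actV action h basepoint ≡ α
    connected : ∀ α β → Star (Adjacent Z) α β
    unflipped : Unflipped action
    faithful : Faithful action

-- vertex v g α is ⟦g , α⟧ ∈ G ×_{H_v} Z_v, and the lifted edge (e , g) runs from sheet g (src e) to sheet (g w(e)) (tgt e).
module InducedCover (X : Graph) (G : FinGroup) (L : Fin (nV X) → EmbeddedPointCover G)
                    (w : Fin (nE X) → Carrier G) where
  private module G = GroupProperties G
  open G using (_∙_; _⁻¹)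

  module Local (v : Fin (nV X)) where
    open EmbeddedPointCover (L v) public
    open Embedding H G φ-embedding public
    module ∼V = InducedRelation G H φ-embedding (actV action) (actV-ε action) (actV-∙ action)
    module ∼E = InducedRelation G H φ-embedding (actE action) (actE-ε action) (actE-∙ action)
    module QV = FiniteQuotient (finite-× (finite-Fin (FinGroup.order G)) (finite-Fin (nV Z))) ∼V._∼?_ ∼V.∼-isEquivalence
    module QE = FiniteQuotient (finite-× (finite-Fin (FinGroup.order G)) (finite-Fin (nE Z))) ∼E._∼?_ ∼E.∼-isEquivalence
  open Local using (Z; φ; action; basepoint)

  Vertex : Set
  Vertex = Σ (Fin (nV X)) Local.QV.Q

  Edge : Set
  Edge = (Fin (nE X) × Carrier G) ⊎ Σ (Fin (nV X)) Local.QE.Q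

  abstract
    finite-Vertex : Finite Vertex
    finite-Vertex = finite-Σ (nV X) Local.QV.finite-Q

    finite-Edge : Finite Edge
    finite-Edge = finite-⊎ (finite-× (finite-Fin (nE X)) (finite-Fin (FinGroup.order G))) (finite-Σ (nV X) Local.QE.finite-Q)

  vertex : ∀ v → Carrier G → Fin (nV (Z v)) → Vertex
  vertex v g α = v , Local.QV.[_] v (g , α)

  fiberEdge : ∀ v → Carrier G → Fin (nE (Z v)) → Edge
  fiberEdge v g η = inj₂ (v , Local.QE.[_] v (g , η))

  source target : Edge → Vertex
  source (inj₁ (e , g)) = vertex (src X e) g (basepoint (src X e))
  source (inj₂ (v , q)) = vertex v (proj₁ (Local.QE.rep v q)) (src (Z v) (proj₂ (Local.QE.rep v q)))
  target (inj₁ (e , g)) = vertex (tgt X e) (g ∙ w e) (basepoint (tgt X e))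
  target (inj₂ (v , q)) = vertex v (proj₁ (Local.QE.rep v q)) (tgt (Z v) (proj₂ (Local.QE.rep v q)))

  Joins : Edge → Vertex → Vertex → Set
  Joins x a b = (source x ≡ a × target x ≡ b) ⊎ (source x ≡ b × target x ≡ a)

  Joins-sym : ∀ x {a b} → Joins x a b → Joins x b a
  Joins-sym x (inj₁ (p , q)) = inj₂ (p , q)
  Joins-sym x (inj₂ (p , q)) = inj₁ (p , q)

  Joins-resp : ∀ x {a b a′ b′} → a ≡ a′ → b ≡ b′ → Joins x a b → Joins x a′ b′
  Joins-resp x refl refl j = j

  vertex-φ : ∀ v g h α → vertex v (g ∙ φ v h) α ≡ vertex v g (actV (action v) h α)
  vertex-φ v g h α = cong (v ,_) (Local.QV.[]-cong v (Local.∼V.∼-φ v g h α))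

  vertex-rep : ∀ v q → (v , q) ≡ vertex v (proj₁ (Local.QV.rep v q)) (proj₂ (Local.QV.rep v q))
  vertex-rep v q = cong (v ,_) (sym (Local.QV.[]-rep v q))

  vertex-exact : ∀ {v g α g′ α′} → vertex v g α ≡ vertex v g′ α′ → Local.∼V._∼_ v (g , α) (g′ , α′)
  vertex-exact {v} e = Local.QV.[]-exact v (,-injectiveʳ-UIP (Decidable⇒UIP.≡-irrelevant _≟_) e)

  fiberEdge-rep : ∀ v q → inj₂ (v , q) ≡ fiberEdge v (proj₁ (Local.QE.rep v q)) (proj₂ (Local.QE.rep v q))
  fiberEdge-rep v q = cong (λ q′ → inj₂ (v , q′)) (sym (Local.QE.[]-rep v q))

  fiberEdge-exact : ∀ {v g η g′ η′} → fiberEdge v g η ≡ fiberEdge v g′ η′ → Local.∼E._∼_ v (g , η) (g′ , η′)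
  fiberEdge-exact {v} e = Local.QE.[]-exact v (,-injectiveʳ-UIP (Decidable⇒UIP.≡-irrelevant _≟_) (inj₂-injective e))

  -- The representative (g′ , η′) of ⟦g , η⟧ has g′ = g φ(h) and η = h η′, so its ends are ⟦g , h src η′⟧, ⟦g , h tgt η′⟧.
  fiberEdge-joins : ∀ v g η → Joins (fiberEdge v g η) (vertex v g (src (Z v) η)) (vertex v g (tgt (Z v) η))
  fiberEdge-joins v g η = joins (subst (λ η₀ → HasEnds (Z v) η₀ (hα (src (Z v) η′)) (hα (tgt (Z v) η′))) (sym η≡hη′) (act-ends (action v) h η′))
    where
    representative = Local.QE.rep v (Local.QE.[_] v (g , η))
    g′ = proj₁ representative
    η′ = proj₂ representative
    related = Local.QE.rep-[] v (g , η)
    h = proj₁ related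
    hα = actV (action v) h
    η≡hη′ : η ≡ actE (action v) h η′
    η≡hη′ = proj₂ (proj₂ related)
    end : ∀ α → vertex v g′ α ≡ vertex v g (hα α)
    end α = trans (cong (λ k → vertex v k α) (proj₁ (proj₂ related))) (vertex-φ v g h α)
    joins : HasEnds (Z v) η (hα (src (Z v) η′)) (hα (tgt (Z v) η′)) →
            Joins (fiberEdge v g η) (vertex v g (src (Z v) η)) (vertex v g (tgt (Z v) η))
    joins (inj₁ (p , q)) = inj₁ (trans (end _) (cong (vertex v g) (sym p)) , trans (end _) (cong (vertex v g) (sym q)))
    joins (inj₂ (p , q)) = inj₂ (trans (end _) (cong (vertex v g) (sym q)) , trans (end _) (cong (vertex v g) (sym p)))

  translateV : Carrier G → Vertex → Vertex
  translateV k (v , q) = vertex v (k ∙ proj₁ (Local.QV.rep v q)) (proj₂ (Local.QV.rep v q))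

  translateE : Carrier G → Edge → Edge
  translateE k (inj₁ (e , g)) = inj₁ (e , k ∙ g)
  translateE k (inj₂ (v , q)) = fiberEdge v (k ∙ proj₁ (Local.QE.rep v q)) (proj₂ (Local.QE.rep v q))

  translateV-vertex : ∀ k v g α → translateV k (vertex v g α) ≡ vertex v (k ∙ g) α
  translateV-vertex k v g α = cong (v ,_) (Local.QV.[]-cong v (Local.∼V.∼-translate v k (Local.QV.rep-[] v (g , α))))

  translateE-fiberEdge : ∀ k v g η → translateE k (fiberEdge v g η) ≡ fiberEdge v (k ∙ g) η
  translateE-fiberEdge k v g η =
    cong (λ q → inj₂ (v , q)) (Local.QE.[]-cong v (Local.∼E.∼-translate v k (Local.QE.rep-[] v (g , η))))

  translateV-ε : ∀ x → translateV G.ε x ≡ x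
  translateV-ε (v , q) = trans (cong (λ k → vertex v k (proj₂ (Local.QV.rep v q))) (G.identityˡ _)) (sym (vertex-rep v q))

  translateE-ε : ∀ x → translateE G.ε x ≡ x
  translateE-ε (inj₁ (e , g)) = cong (λ k → inj₁ (e , k)) (G.identityˡ g)
  translateE-ε (inj₂ (v , q)) = trans (cong (λ k → fiberEdge v k (proj₂ (Local.QE.rep v q))) (G.identityˡ _)) (sym (fiberEdge-rep v q))

  translateV-∙ : ∀ k k′ x → translateV (k ∙ k′) x ≡ translateV k (translateV k′ x)
  translateV-∙ k k′ (v , q) = trans (cong (λ k″ → vertex v k″ (proj₂ (Local.QV.rep v q))) (G.assoc _ _ _)) (sym (translateV-vertex k v _ _))

  translateE-∙ : ∀ k k′ x → translateE (k ∙ k′) x ≡ translateE k (translateE k′ x)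
  translateE-∙ k k′ (inj₁ (e , g)) = cong (λ k″ → inj₁ (e , k″)) (G.assoc _ _ _)
  translateE-∙ k k′ (inj₂ (v , q)) = trans (cong (λ k″ → fiberEdge v k″ (proj₂ (Local.QE.rep v q))) (G.assoc _ _ _)) (sym (translateE-fiberEdge k v _ _))

  translateE-ends : ∀ k x → Joins (translateE k x) (translateV k (source x)) (translateV k (target x))
  translateE-ends k (inj₁ (e , g)) =
    inj₁ (sym (translateV-vertex k _ _ _) , trans (cong (λ k″ → vertex (tgt X e) k″ (basepoint (tgt X e))) (G.assoc _ _ _)) (sym (translateV-vertex k _ _ _)))
  translateE-ends k (inj₂ (v , q)) =
    Joins-resp (translateE k (inj₂ (v , q))) (sym (translateV-vertex k v _ _)) (sym (translateV-vertex k v _ _)) (fiberEdge-joins v _ _)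

  Joins-translate : ∀ k {x a b} → Joins x a b → Joins (translateE k x) (translateV k a) (translateV k b)
  Joins-translate k {x} (inj₁ (refl , refl)) = translateE-ends k x
  Joins-translate k {x} (inj₂ (refl , refl)) = Joins-sym (translateE k x) (translateE-ends k x)

  source≢target : ∀ x → source x ≢ target x
  source≢target (inj₁ (e , g)) eq = noLoop X e (cong proj₁ eq)
  source≢target (inj₂ (v , q)) eq with Local.∼V.∼-sameGroupElement v _ (vertex-exact eq)
  ... | h , φh≡ε , moved = noLoop (Z v) _ (sym (trans moved (trans (cong (λ h′ → actV (action v) h′ _) h≡ε) (actV-ε (action v) _))))
    where
    h≡ε : h ≡ FinGroup.ε (Local.H v)
    h≡ε = Local.trivial-kernel v h φh≡ε

  private
    module FV = Finite finite-Vertex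
    module FE = Finite finite-Edge

  𝒴 : Graph
  𝒴 = record
    { nV = FV.size ; nE = FE.size
    ; src = FV.to ∘ source ∘ FE.from ; tgt = FV.to ∘ target ∘ FE.from
    ; noLoop = λ i eq → source≢target (FE.from i) (FV.to-injective eq) }

  Joins⇒HasEnds : ∀ {x a b} → Joins x a b → HasEnds 𝒴 (FE.to x) (FV.to a) (FV.to b)
  Joins⇒HasEnds {x} j with FE.from (FE.to x) | FE.from-to x
  Joins⇒HasEnds {x} (inj₁ (refl , refl)) | .x | refl = inj₁ (refl , refl)
  Joins⇒HasEnds {x} (inj₂ (refl , refl)) | .x | refl = inj₂ (refl , refl)

  translation : Action G 𝒴
  translation = record
    { actV = λ k → FV.to ∘ translateV k ∘ FV.from
    ; actE = λ k → FE.to ∘ translateE k ∘ FE.from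
    ; actV-ε = λ i → trans (cong FV.to (translateV-ε _)) (FV.to-from i)
    ; actE-ε = λ i → trans (cong FE.to (translateE-ε _)) (FE.to-from i)
    ; actV-∙ = λ k k′ i → cong FV.to (trans (translateV-∙ k k′ _) (cong (translateV k) (sym (FV.from-to _))))
    ; actE-∙ = λ k k′ i → cong FE.to (trans (translateE-∙ k k′ _) (cong (translateE k) (sym (FE.from-to _))))
    ; act-ends = λ k i → Joins⇒HasEnds (Joins-resp (translateE k (FE.from i))
        (cong (translateV k) (sym (FV.from-to _))) (cong (translateV k) (sym (FV.from-to _))) (translateE-ends k (FE.from i))) }

  edgeImage : Edge → Fin (nE X) ⊎ Fin (nV X)
  edgeImage (inj₁ (e , _)) = inj₁ e
  edgeImage (inj₂ (v , _)) = inj₂ v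

  edgeImage-translate : ∀ k x → edgeImage (translateE k x) ≡ edgeImage x
  edgeImage-translate k (inj₁ _) = refl
  edgeImage-translate k (inj₂ _) = refl

  projection : Morphism 𝒴 X
  projection = record
    { fV = proj₁ ∘ FV.from
    ; fE = edgeImage ∘ FE.from
    ; edge-ok = λ i e′ eq → subst₂ (HasEnds X e′) (sym (base (source (FE.from i)))) (sym (base (target (FE.from i))))
                                   (liftedEdge-ends (FE.from i) eq)
    ; vert-ok = λ i v eq → map (trans (base (source (FE.from i)))) (trans (base (target (FE.from i))))
                                              (fiberEdge-ends (FE.from i) eq) }
    where
    base : ∀ a → proj₁ (FV.from (FV.to a)) ≡ proj₁ a
    base a = cong proj₁ (FV.from-to a)
    liftedEdge-ends : ∀ x {e′} → edgeImage x ≡ inj₁ e′ → HasEnds X e′ (proj₁ (source x)) (proj₁ (target x))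
    liftedEdge-ends (inj₁ (e , g)) refl = inj₁ (refl , refl)
    fiberEdge-ends : ∀ x {v} → edgeImage x ≡ inj₂ v → (proj₁ (source x) ≡ v) × (proj₁ (target x) ≡ v)
    fiberEdge-ends (inj₂ (v , q)) refl = refl , refl

  vertex-onto : ∀ x → ∃ λ g → x ≡ vertex (proj₁ x) g (basepoint (proj₁ x))
  vertex-onto (v , q) with Local.transitive v (proj₂ (Local.QV.rep v q))
  ... | a , a·ζ = proj₁ (Local.QV.rep v q) ∙ φ v a ,
    trans (vertex-rep v q) (trans (cong (vertex v _) (sym a·ζ)) (sym (vertex-φ v _ a (basepoint v))))

  translateV-transitive : ∀ {v} q q′ → ∃ λ k → translateV k (v , q) ≡ (v , q′)
  translateV-transitive {v} q q′ with vertex-onto (v , q) | vertex-onto (v , q′)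
  ... | g , x≡ | g′ , x′≡ = g′ G.// g , (begin
    translateV (g′ G.// g) (v , q)                ≡⟨ cong (translateV (g′ G.// g)) x≡ ⟩
    translateV (g′ G.// g) (vertex v g (basepoint v)) ≡⟨ translateV-vertex (g′ G.// g) v g (basepoint v) ⟩
    vertex v ((g′ G.// g) ∙ g) (basepoint v)      ≡⟨ cong (λ k → vertex v k (basepoint v)) (G.//-rightDividesˡ g g′) ⟩
    vertex v g′ (basepoint v)                     ≡⟨ sym x′≡ ⟩
    (v , q′)                                      ∎)
    where open ≡-Reasoning

  translateE-transitive : ∀ x x′ e′ → edgeImage x ≡ inj₁ e′ → edgeImage x′ ≡ inj₁ e′ → ∃ λ k → translateE k x ≡ x′
  translateE-transitive (inj₁ (e , g)) (inj₁ (.e , g′)) .e refl refl = g′ G.// g , cong (λ k → inj₁ (e , k)) (G.//-rightDividesˡ g g′)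

  isQuotient : IsQuotientBy translation (λ _ → ⊤) projection
  isQuotient = record
    { V-surj = λ v → FV.to (vertex v G.ε (basepoint v)) , cong proj₁ (FV.from-to _)
    ; V-ker₁ = λ y y′ eq → V-ker (FV.from y) (FV.from y′) eq y′ (FV.to-from y′)
    ; V-ker₂ = λ y y′ k _ eq → trans (sym (cong proj₁ (FV.from-to (translateV k (FV.from y))))) (cong (proj₁ ∘ FV.from) eq)
    ; E-surj = λ e′ → FE.to (inj₁ (e′ , G.ε)) , cong edgeImage (FE.from-to _)
    ; E-ker₁ = λ e₁ e₂ e′ f₁ f₂ → let k , moves = translateE-transitive (FE.from e₁) (FE.from e₂) e′ f₁ f₂ in
        k , tt , trans (cong FE.to moves) (FE.to-from e₂)
    ; E-ker₂ = λ e₁ e₂ e′ k f₁ _ eq → trans (sym (cong (edgeImage ∘ FE.from) eq))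
        (trans (cong edgeImage (FE.from-to (translateE k (FE.from e₁)))) (trans (edgeImage-translate k (FE.from e₁)) f₁)) }
    where
    V-ker : ∀ x x′ → proj₁ x ≡ proj₁ x′ → ∀ y′ → FV.to x′ ≡ y′ → ∃ λ k → ⊤ × FV.to (translateV k x) ≡ y′
    V-ker (v , q) (.v , q′) refl y′ refl = let k , moves = translateV-transitive q q′ in k , tt , cong FV.to moves

  translation-unflipped : Unflipped translation
  translation-unflipped k i fixed = unflipped (FE.from i) (trans (sym (FE.from-to _)) (cong FE.from fixed))
    where
    unflipped : ∀ x → translateE k x ≡ x → k ≡ G.ε
    unflipped (inj₁ (e , g)) eq = G.identityˡ-unique k g (cong proj₂ (inj₁-injective eq))
    unflipped (inj₂ (v , q)) eq with fiberEdge-exact (trans eq (fiberEdge-rep v q))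
    ... | h , kg≡gφh , η≡hη = G.identityˡ-unique k _ (trans kg≡gφh (trans (cong (proj₁ (Local.QE.rep v q) ∙_) φh≡ε) (G.identityʳ _)))
      where
      φh≡ε : φ v h ≡ G.ε
      φh≡ε = trans (cong (φ v) (Local.unflipped v h _ (sym η≡hη))) (Local.ε-homo v)

  -- An element fixing the fibre over r fixes ⟦ε , α⟧ for all α, hence equals φ(h) with h acting trivially on Z_r.
  translation-faithful : Fin (nV X) → Faithful translation
  translation-faithful r k fixesV fixesE = trans k≡φh (trans (cong (φ r) h≡ε) (Local.ε-homo r))
    where
    stabiliser : ∀ {α} → translateV k (vertex r G.ε α) ≡ vertex r G.ε α → ∃ λ h → k ≡ φ r h × α ≡ actV (action r) h α
    stabiliser {α} eq with vertex-exact (trans (sym (translateV-vertex k r G.ε α)) eq)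
    ... | h , kε≡εφh , α≡hα = h , trans (sym (G.identityʳ k)) (trans kε≡εφh (G.identityˡ _)) , α≡hα
    stabiliserE : ∀ {η} → translateE k (fiberEdge r G.ε η) ≡ fiberEdge r G.ε η → ∃ λ h → k ≡ φ r h × η ≡ actE (action r) h η
    stabiliserE {η} eq with fiberEdge-exact (trans (sym (translateE-fiberEdge k r G.ε η)) eq)
    ... | h , kε≡εφh , η≡hη = h , trans (sym (G.identityʳ k)) (trans kε≡εφh (G.identityˡ _)) , η≡hη
    fixedV : ∀ α → translateV k (vertex r G.ε α) ≡ vertex r G.ε α
    fixedV α = trans (cong (translateV k) (sym (FV.from-to _))) (trans (sym (FV.from-to _)) (trans (cong FV.from (fixesV _)) (FV.from-to _)))
    fixedE : ∀ η → translateE k (fiberEdge r G.ε η) ≡ fiberEdge r G.ε η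
    fixedE η = trans (cong (translateE k) (sym (FE.from-to _))) (trans (sym (FE.from-to _)) (trans (cong FE.from (fixesE _)) (FE.from-to _)))
    h = proj₁ (stabiliser (fixedV (basepoint r)))
    k≡φh : k ≡ φ r h
    k≡φh = proj₁ (proj₂ (stabiliser (fixedV (basepoint r))))
    h≡ε : h ≡ FinGroup.ε (Local.H r)
    h≡ε = Local.faithful r h
      (λ α → let h′ , k≡φh′ , α≡h′α = stabiliser (fixedV α) in
        trans (cong (λ h″ → actV (action r) h″ α) (Local.injective r (trans (sym k≡φh) k≡φh′))) (sym α≡h′α))
      (λ η → let h′ , k≡φh′ , η≡h′η = stabiliserE (fixedE η) in
        trans (cong (λ h″ → actE (action r) h″ η) (Local.injective r (trans (sym k≡φh) k≡φh′))) (sym η≡h′η))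

  totallySplitAt-trivial : ∀ z → (Fin (nE (Z z)) → ⊥) → (∀ h → φ z h ≡ G.ε) → TotallySplitAt translation projection z
  totallySplitAt-trivial z no-edges φ-trivial y y-over g path =
    fixed-only-by-ε (FV.from y) y-over (trans (sym (FV.from-to _)) (cong FV.from (sym (Star-empty no-fiber-adjacency path))))
    where
    no-fiber-edge : ∀ x → edgeImage x ≢ inj₂ z
    no-fiber-edge (inj₂ (v , q)) refl = no-edges (proj₂ (Local.QE.rep v q))
    no-fiber-adjacency : ∀ {a b} → ¬ FiberAdj projection z a b
    no-fiber-adjacency (e , over-z , _) = no-fiber-edge (FE.from e) over-z
    fixed-only-by-ε : ∀ x → proj₁ x ≡ z → translateV g x ≡ x → g ≡ G.ε
    fixed-only-by-ε (v , q) refl eq with vertex-exact (trans eq (vertex-rep v q))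
    ... | h , gg₀≡g₀φh , _ = G.identityˡ-unique g _ (trans gg₀≡g₀φh (trans (cong (proj₁ (Local.QV.rep v q) ∙_) (φ-trivial h)) (G.identityʳ _)))

  fiberIsoInduced : ∀ b → FiberIsoInduced translation projection b (action b) (φ b)
  fiberIsoInduced b = record
    { ΨV = λ g α → FV.to (vertex b g α)
    ; ΨE = λ g η → FE.to (fiberEdge b g η)
    ; ΨV-fib = λ g α → cong proj₁ (FV.from-to _)
    ; ΨE-fib = λ g η → cong edgeImage (FE.from-to _)
    ; ΨV-surj = λ y over-b → vertex-surj (FV.from y) over-b y (FV.to-from y)
    ; ΨE-surj = λ e over-b → fiberEdge-surj (FE.from e) over-b e (FE.to-from e)
    ; ΨV-ker₁ = λ g α g′ α′ eq → vertex-exact (FV.to-injective eq)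
    ; ΨV-ker₂ = λ g α g′ α′ h g≡g′φh α′≡hα → cong (λ q → FV.to (b , q)) (Local.QV.[]-cong b (h , g≡g′φh , α′≡hα))
    ; ΨE-ker₁ = λ g η g′ η′ eq → fiberEdge-exact (FE.to-injective eq)
    ; ΨE-ker₂ = λ g η g′ η′ h g≡g′φh η′≡hη → cong (λ q → FE.to (inj₂ (b , q))) (Local.QE.[]-cong b (h , g≡g′φh , η′≡hη))
    ; ΨV-equiv = λ k g α → cong FV.to (trans (cong (translateV k) (FV.from-to _)) (translateV-vertex k b g α))
    ; ΨE-equiv = λ k g η → cong FE.to (trans (cong (translateE k) (FE.from-to _)) (translateE-fiberEdge k b g η))
    ; Ψ-ends = λ g η → Joins⇒HasEnds (fiberEdge-joins b g η) }
    where
    vertex-surj : ∀ x → proj₁ x ≡ b → ∀ y → FV.to x ≡ y → ∃₂ λ g α → FV.to (vertex b g α) ≡ y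
    vertex-surj (v , q) refl y refl = _ , _ , cong FV.to (sym (vertex-rep v q))
    fiberEdge-surj : ∀ x → edgeImage x ≡ inj₂ b → ∀ e → FE.to x ≡ e → ∃₂ λ g η → FE.to (fiberEdge b g η) ≡ e
    fiberEdge-surj (inj₂ (v , q)) refl e refl = _ , _ , cong FE.to (sym (fiberEdge-rep v q))


  Linked : Vertex → Vertex → Set
  Linked a b = ∃ λ x → Joins x a b

  Path : Vertex → Vertex → Set
  Path = Star Linked

  reversePath : ∀ {a b} → Path a b → Path b a
  reversePath = reverse (λ { (x , j) → x , Joins-sym x j })

  Path⇒Star : ∀ {a b} → Path a b → Star (Adjacent 𝒴) (FV.to a) (FV.to b)
  Path⇒Star = gmap FV.to (λ { (x , j) → FE.to x , Joins⇒HasEnds j })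

  translatePath : ∀ k {a b} → Path a b → Path (translateV k a) (translateV k b)
  translatePath k = gmap (translateV k) (λ { (x , j) → translateE k x , Joins-translate k {x} j })

  fiberPath : ∀ v g {α β} → Star (Adjacent (Z v)) α β → Path (vertex v g α) (vertex v g β)
  fiberPath v g = gmap (vertex v g) λ { (η , ends) → fiberEdge v g η , HasEnds⇒Joins ends }
    where
    HasEnds⇒Joins : ∀ {η α β} → HasEnds (Z v) η α β → Joins (fiberEdge v g η) (vertex v g α) (vertex v g β)
    HasEnds⇒Joins {η} (inj₁ (refl , refl)) = fiberEdge-joins v g η
    HasEnds⇒Joins {η} (inj₂ (refl , refl)) = Joins-sym (fiberEdge v g η) (fiberEdge-joins v g η)

  sheet : Carrier G → Fin (nV X) → Vertex
  sheet g v = vertex v g (basepoint v)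

  toSheet : ∀ x → ∃ λ g → Path x (sheet g (proj₁ x))
  toSheet (v , q) = proj₁ (Local.QV.rep v q) ,
    subst (λ x → Path x (sheet (proj₁ (Local.QV.rep v q)) v)) (sym (vertex-rep v q)) (fiberPath v _ (Local.connected v _ (basepoint v)))

  LocalOrLabel : Carrier G → Set
  LocalOrLabel x = (∃₂ λ v h → φ v h ≡ x) ⊎ (∃ λ e → w e ≡ x)

  module Connectivity (t : SpanningTree X) (w-tree : ∀ e → SpanningTree.inTree t e ≡ true → w e ≡ G.ε) where
    open SpanningTree t

    treePath : ∀ g v → Path (sheet g root) (sheet g v)
    treePath g v = gmap (sheet g) liftEdge (reaches v)
      where
      liftEdge : ∀ {a b} → TreeAdj X inTree a b → Linked (sheet g a) (sheet g b)
      liftEdge {a} {b} (e , te , ends) = inj₁ (e , g) , along ends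
        where
        target≡ : target (inj₁ (e , g)) ≡ sheet g (tgt X e)
        target≡ = cong (λ k → sheet k (tgt X e)) (trans (cong (g ∙_) (w-tree e te)) (G.identityʳ g))
        along : HasEnds X e a b → Joins (inj₁ (e , g)) (sheet g a) (sheet g b)
        along (inj₁ (refl , refl)) = inj₁ (refl , target≡)
        along (inj₂ (refl , refl)) = inj₂ (refl , target≡)

    Reachable : Carrier G → Set
    Reachable g = Path (sheet g root) (sheet G.ε root)

    translateSheetPath : ∀ k {g g′} → Path (sheet g root) (sheet g′ root) → Path (sheet (k ∙ g) root) (sheet (k ∙ g′) root)
    translateSheetPath k p = subst₂ Path (translateV-vertex k root _ _) (translateV-vertex k root _ _) (translatePath k p)

    reachable-isSubgroup : IsSubgroup G Reachable
    reachable-isSubgroup = record { ε-mem = [] ; ∙-mem = reachable-∙ ; ⁻¹-mem = reachable-⁻¹ }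
      where
      reachable-∙ : ∀ {x y} → Reachable x → Reachable y → Reachable (x ∙ y)
      reachable-∙ {x} {y} rx ry = subst (λ k → Path (sheet (x ∙ y) root) (sheet k root)) (G.identityʳ x) (translateSheetPath x ry) ◅◅ rx
      reachable-⁻¹ : ∀ {x} → Reachable x → Reachable (x ⁻¹)
      reachable-⁻¹ {x} rx = reversePath (subst₂ (λ k k′ → Path (sheet k root) (sheet k′ root)) (G.inverseˡ x) (G.identityʳ (x ⁻¹))
                                       (translateSheetPath (x ⁻¹) rx))

    reachable-φ : ∀ v h → Reachable (φ v h)
    reachable-φ v h = treePath (φ v h) v ◅◅
      (subst (λ x → Path x (sheet G.ε v)) (sym (trans (cong (λ k → sheet k v) (sym (G.identityˡ _))) (vertex-φ v G.ε h _)))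
             (fiberPath v G.ε (Local.connected v _ (basepoint v))) ◅◅ reversePath (treePath G.ε v))

    reachable-w : ∀ e → Reachable (w e)
    reachable-w e = treePath (w e) (tgt X e) ◅◅
      ((inj₁ (e , G.ε) , inj₂ (refl , cong (λ k → sheet k (tgt X e)) (G.identityˡ (w e)))) ◅ reversePath (treePath G.ε (src X e)))

    connected : (∀ g → Generated G LocalOrLabel g) → Connected 𝒴
    connected generated = >-nonZero⁻¹ _ {{nonZeroIndex (FV.to (sheet G.ε root))}} , λ a b →
      subst₂ (Star (Adjacent 𝒴)) (FV.to-from a) (FV.to-from b) (Path⇒Star (toRoot (FV.from a) ◅◅ reversePath (toRoot (FV.from b))))
      where
      reachable : ∀ g → Reachable g
      reachable g = Generated-minimal reachable-isSubgroup generators-reachable (generated g)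
        where
        generators-reachable : ∀ {x} → LocalOrLabel x → Reachable x
        generators-reachable (inj₁ (v , h , refl)) = reachable-φ v h
        generators-reachable (inj₂ (e , refl)) = reachable-w e
      toRoot : ∀ x → Path x (sheet G.ε root)
      toRoot x = let g , p = toSheet x in p ◅◅ reversePath (treePath g (proj₁ x)) ◅◅ reachable g

    isCover : (∀ g → Generated G LocalOrLabel g) → IsCover translation projection
    isCover generated = record
      { connected = connected generated
      ; faithful = translation-faithful root
      ; unflipped = translation-unflipped
      ; harmonicA = Unflipped⇒HarmonicAction translation translation-unflipped
      ; harmonicF = Unflipped⇒quotient-harmonic translation translation-unflipped isQuotient
      ; invV = λ g y → cong proj₁ (FV.from-to (translateV g (FV.from y)))
      ; invE = λ g e → trans (cong edgeImage (FE.from-to (translateE g (FE.from e)))) (edgeImage-translate g (FE.from e))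
      ; quotient = isQuotient }

Fin1-unique : (a b : Fin 1) → a ≡ b
Fin1-unique zero zero = refl

trivialGroup : FinGroup
trivialGroup = record { order = 1 ; _∙_ = λ _ _ → zero ; ε = zero ; _⁻¹ = λ _ → zero ; isGroup = isGroup }
  where
  isGroup : IsGroup _≡_ (λ (_ _ : Fin 1) → zero) zero (λ _ → zero)
  isGroup = record
    { isMonoid = record
      { isSemigroup = record
        { isMagma = record { isEquivalence = isEquivalence ; ∙-cong = λ _ _ → refl }
        ; assoc = λ _ _ _ → refl }
      ; identity = Fin1-unique _ , Fin1-unique _ }
    ; inverse = (λ _ → refl) , (λ _ → refl)
    ; ⁻¹-cong = λ _ → refl }

trivialPointCover : ∀ G → EmbeddedPointCover G
trivialPointCover G = record
  { H = trivialGroup ; Z = pointGraph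
  ; action = record { actV = λ _ α → α ; actE = λ _ η → η ; actV-ε = λ _ → refl ; actE-ε = λ _ → refl
                    ; actV-∙ = λ _ _ _ → refl ; actE-∙ = λ _ _ _ → refl ; act-ends = λ _ () }
  ; φ = λ _ → G.ε
  ; φ-embedding = record
    { isGroupHomomorphism = record
      { isMonoidHomomorphism = record
        { isMagmaHomomorphism = record { isRelHomomorphism = record { cong = λ _ → refl } ; homo = λ _ _ → sym (G.identityˡ G.ε) }
        ; ε-homo = refl }
      ; ⁻¹-homo = λ _ → sym G.ε⁻¹≈ε }
    ; injective = λ _ → Fin1-unique _ _ }
  ; basepoint = zero
  ; transitive = λ α → zero , Fin1-unique _ _
  ; connected = λ { zero zero → [] }
  ; unflipped = λ _ ()
  ; faithful = λ h _ _ → Fin1-unique _ _ }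
  where module G = GroupProperties G

-- Transitivity holds because the quotient of a cover of the point is a single vertex.
pointCover : ∀ {G H Y} {A : Action H Y} {π : Morphism Y pointGraph} → IsCover A π →
             (φ : Carrier H → Carrier G) → IsEmbedding H G φ → EmbeddedPointCover G
pointCover {H = H} {Y} {A} cov φ emb = record
  { H = H ; Z = Y ; action = A ; φ = φ ; φ-embedding = emb
  ; basepoint = ζ
  ; transitive = λ α → let h , _ , hζ≡α = V-ker₁ ζ α (Fin1-unique _ _) in h , hζ≡α
  ; connected = proj₂ connected
  ; unflipped = unflipped
  ; faithful = faithful }
  where
  open IsCover cov
  open IsQuotientBy quotient using (V-ker₁)
  ζ : Fin (nV Y)
  ζ = fromℕ< (proj₁ connected)

module Construction (X : Graph) (cX : Connected X) (B : Subset (nV X)) (G : FinGroup)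
    {Gb : (b : Fin (nV X)) → b ∈ B → FinGroup}
    {Yb : (b : Fin (nV X)) → b ∈ B → Graph}
    {Ab : (b : Fin (nV X)) (p : b ∈ B) → Action (Gb b p) (Yb b p)}
    {πb : (b : Fin (nV X)) (p : b ∈ B) → Morphism (Yb b p) pointGraph}
    (cov : (b : Fin (nV X)) (p : b ∈ B) → IsCover (Ab b p) (πb b p))
    {φ : (b : Fin (nV X)) (p : b ∈ B) → Carrier (Gb b p) → Carrier G}
    (emb : (b : Fin (nV X)) (p : b ∈ B) → IsEmbedding (Gb b p) G (φ b p))
    (γ : Fin (genus X) → Carrier G) where
  private module G = GroupProperties G

  localCover : Fin (nV X) → EmbeddedPointCover G
  localCover v with v ∈? B
  ... | yes p = pointCover (cov v p) (φ v p) (emb v p)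
  ... | no _ = trivialPointCover G

  localCover-∈ : ∀ b p → localCover b ≡ pointCover (cov b p) (φ b p) (emb b p)
  localCover-∈ b p with b ∈? B
  ... | yes p′ rewrite []=-irrelevant p p′ = refl
  ... | no b∉B = contradiction p b∉B

  localCover-∉ : ∀ z → ¬ z ∈ B → localCover z ≡ trivialPointCover G
  localCover-∉ z z∉B with z ∈? B
  ... | yes z∈B = contradiction z∈B z∉B
  ... | no _ = refl

  tree : SpanningTree X
  tree = SpanningTreeConstruction.spanningTree X cX

  open Cotree tree using (label; label-inTree; label-cotreeEdge; cotreeEdge)

  w : Fin (nE X) → Carrier G
  w = label G.ε γ

  open InducedCover X G localCover w public
  open Connectivity tree (λ e → label-inTree G.ε γ) public

  generatedByLocalOrLabel : (∀ x → Generated G (λ y → Generated G (λ z → ∃ λ b → Σ (b ∈ B) λ p → ∃ λ h → φ b p h ≡ z) y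
                                                       ⊎ ∃ λ i → γ i ≡ y) x) →
                            ∀ x → Generated G LocalOrLabel x
  generatedByLocalOrLabel generated x = Generated-minimal Generated-isSubgroup generator (generated x)
    where
    local : ∀ {z} → (∃ λ b → Σ (b ∈ B) λ p → ∃ λ h → φ b p h ≡ z) → Generated G LocalOrLabel z
    local (b , p , h , refl) = gen (inj₁ (b , subst (λ ℓ → ∃ λ h′ → EmbeddedPointCover.φ ℓ h′ ≡ φ b p h) (sym (localCover-∈ b p)) (h , refl)))
    generator : ∀ {y} → Generated G _ y ⊎ ∃ (λ i → γ i ≡ y) → Generated G LocalOrLabel y
    generator (inj₁ g) = Generated-minimal Generated-isSubgroup local g
    generator (inj₂ (i , refl)) = gen (inj₂ (cotreeEdge i , label-cotreeEdge G.ε γ i))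

  totallySplitOutside : TotallySplitOutside translation projection B
  totallySplitOutside z z∉B = totallySplitAt-trivial z
    (subst (λ ℓ → Fin (nE (EmbeddedPointCover.Z ℓ)) → ⊥) (sym (localCover-∉ z z∉B)) λ ())
    (subst (λ ℓ → ∀ h → EmbeddedPointCover.φ ℓ h ≡ G.ε) (sym (localCover-∉ z z∉B)) λ _ → refl)

  fiberIso : ∀ b p → FiberIsoInduced translation projection b (Ab b p) (φ b p)
  fiberIso b p = subst (λ ℓ → FiberIsoInduced translation projection b (EmbeddedPointCover.action ℓ) (EmbeddedPointCover.φ ℓ))
                       (localCover-∈ b p) (fiberIsoInduced b)

theorem6p2 :
    (X : Graph) → Connected X →
    (B : Subset (nV X)) →
    (G : FinGroup) →
    (Gb : (b : Fin (nV X)) → b ∈ B → FinGroup) →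
    (Yb : (b : Fin (nV X)) → b ∈ B → Graph) →
    (Ab : (b : Fin (nV X)) (p : b ∈ B) → Action (Gb b p) (Yb b p)) →
    (πb : (b : Fin (nV X)) (p : b ∈ B) → Morphism (Yb b p) pointGraph) →
    ((b : Fin (nV X)) (p : b ∈ B) → IsCover (Ab b p) (πb b p)) →
    (φ : (b : Fin (nV X)) (p : b ∈ B) → Carrier (Gb b p) → Carrier G) →
    ((b : Fin (nV X)) (p : b ∈ B) → IsEmbedding (Gb b p) G (φ b p)) →
    (γ : Fin (genus X) → Carrier G) →
    ((x : Carrier G) →
      Generated G
        (λ y → Generated G (λ z → ∃ λ b → Σ (b ∈ B) λ p → ∃ λ h → φ b p h ≡ z) y
               ⊎ ∃ λ i → γ i ≡ y)
        x) →
    Σ Graph λ 𝒴 → Σ (Action G 𝒴) λ A → Σ (Morphism 𝒴 X) λ f →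
      IsCover A f × TotallySplitOutside A f B ×
      ((b : Fin (nV X)) (p : b ∈ B) → FiberIsoInduced A f b (Ab b p) (φ b p))
theorem6p2 X cX B G Gb Yb Ab πb cov φ emb γ generated =
  𝒴 , translation , projection , isCover (generatedByLocalOrLabel generated) , totallySplitOutside , fiberIso
  where open Construction X cX B G cov emb γ
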